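{- Let $\Delta$ be a labeled hypergraph on $[d]$ (with respect to a fixed integer $n$) such that $i+j\ge v_\Delta(e_1\cap e_2)+v_\Delta(e_1\cup e_2)$ for all $0\le i,j\le n-1$, $e_1\in\Delta_i$, $e_2\in\Delta_j$, and let $M_\Delta$ be the matroid on $[d]$ whose circuits are the inclusion-minimal sets in $\bigcup_{i}\bigcup_{e\in\Delta_i}\binom{e}{i+1}\cup\binom{[d]}{n+1}$. Then $M_\Delta$ is the unique maximal element, in the weak order, of the set $\{N : N\preceq\Delta,\ \mathrm{rank}(N)\le n\}$ of matroids on $[d]$.
   Context: A labeled hypergraph $\Delta$ on $[d]$ is a collection of subsets (edges) each labeled with a Type $i\in\{0,\dots,n-1\}$, such that no two edges of the same type are properly contained in one another and each edge of Type $i$ has at least $i+1$ elements; $\Delta_i$ is the set of edges of Type $i$. $v_\Delta(A)=\min\{|A|,\ n,\ |A\setminus e|+i : 0\le i\le n-1,\ e\in\Delta_i\}$. For a matroid $N$ on $[d]$, $N\preceq\Delta$ means $\mathrm{rank}_N(e)\le i$ for all $e\in\Delta_i$. Weak order: $N_2\le N_1$ iff every dependent set of $N_1$ is dependent in $N_2$. (That the stated collection is the circuit set of a matroid is part of the setup.) -}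

module Defs where

open import Data.Nat using (ℕ; zero; suc; _+_; _≤_; _<_; _⊓_)
open import Data.Bool using (Bool; true; false)
open import Data.Fin using (Fin; toℕ)
open import Data.Fin.Subset using (Subset; _⊆_; _∈_; _∉_; _∪_; _∩_; _─_; ⁅_⁆; ∣_∣; ⊥; ⊤; outside; inside)
open import Data.Fin.Subset.Properties using (_⊆?_)
open import Data.List using (List; []; _∷_; map; concatMap; foldr; allFin; filter; _++_)
open import Data.Vec using (_∷_)
open import Data.Product using (Σ; _×_; ∃; ∃-syntax; _,_)
open import Data.Sum using (_⊎_)
open import Relation.Binary.PropositionalEquality using (_≡_)
open import Relation.Nullary using (¬_)
open import Relation.Nullary.Decidable using (_×-dec_)
open import Data.Bool using (_≟_)

allSubsets : (d : ℕ) → List (Subset d)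
allSubsets zero = Data.Vec.[] ∷ []
allSubsets (suc d) = map (outside ∷_) (allSubsets d) ++ map (inside ∷_) (allSubsets d)

maxList : List ℕ → ℕ
maxList = foldr Data.Nat._⊔_ 0

record Matroid (d : ℕ) : Set where
  field
    indep      : Subset d → Bool
    indep-∅    : indep ⊥ ≡ true
    hereditary : ∀ {A B} → indep B ≡ true → A ⊆ B → indep A ≡ true
    augment    : ∀ {A B} → indep A ≡ true → indep B ≡ true → ∣ A ∣ < ∣ B ∣ →
                 ∃[ x ] (x ∈ B × x ∉ A × indep (A ∪ ⁅ x ⁆) ≡ true)
open Matroid public

Dependent : ∀ {d} → Matroid d → Subset d → Set
Dependent N A = indep N A ≡ false

IsCircuit : ∀ {d} → Matroid d → Subset d → Set
IsCircuit N C = Dependent N C × (∀ T → T ⊆ C → Dependent N T → T ≡ C)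

rank : ∀ {d} → Matroid d → Subset d → ℕ
rank {d} N A = maxList (map ∣_∣ (filter (λ B → (B ⊆? A) ×-dec (indep N B ≟ true)) (allSubsets d)))

matroidRank : ∀ {d} → Matroid d → ℕ
matroidRank N = rank N ⊤

_≤w_ : ∀ {d} → Matroid d → Matroid d → Set
N₂ ≤w N₁ = ∀ A → Dependent N₁ A → Dependent N₂ A

SameMatroid : ∀ {d} → Matroid d → Matroid d → Set
SameMatroid N₁ N₂ = ∀ A → indep N₁ A ≡ indep N₂ A

record LabeledHypergraph (n d : ℕ) : Set where
  field
    -- isEdge i e ≡ true  iff  e ∈ Δ_i
    isEdge    : Fin n → Subset d → Bool
    antichain : ∀ i {e f} → isEdge i e ≡ true → isEdge i f ≡ true → ¬ (e ⊆ f × ¬ e ≡ f)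
    bigEnough : ∀ i e → isEdge i e ≡ true → suc (toℕ i) ≤ ∣ e ∣
open LabeledHypergraph public

_∈Δ[_]_ : ∀ {n d} → Subset d → Fin n → LabeledHypergraph n d → Set
e ∈Δ[ i ] Δ = isEdge Δ i e ≡ true

-- v_Δ(A) = min{ |A|, n, |A ∖ e| + i : e ∈ Δ_i }
vΔ : ∀ {n d} → LabeledHypergraph n d → Subset d → ℕ
vΔ {n} {d} Δ A =
  foldr _⊓_ (∣ A ∣ ⊓ n)
    (concatMap (λ i → map (λ e → ∣ A ─ e ∣ + toℕ i)
                          (filter (λ e → isEdge Δ i e ≟ true) (allSubsets d)))
               (allFin n))

_⪯_ : ∀ {n d} → Matroid d → LabeledHypergraph n d → Set
N ⪯ Δ = ∀ i e → e ∈Δ[ i ] Δ → rank N e ≤ toℕ i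

InCollection : ∀ {n d} → LabeledHypergraph n d → Subset d → Set
InCollection {n} Δ S =
  (∃[ i ] ∃[ e ] (e ∈Δ[ i ] Δ × S ⊆ e × ∣ S ∣ ≡ suc (toℕ i))) ⊎ ∣ S ∣ ≡ suc n

MinimalInCollection : ∀ {n d} → LabeledHypergraph n d → Subset d → Set
MinimalInCollection Δ S = InCollection Δ S × (∀ T → InCollection Δ T → T ⊆ S → T ≡ S)

InFamily : ∀ {n d} → LabeledHypergraph n d → Matroid d → Set
InFamily {n} Δ N = N ⪯ Δ × matroidRank N ≤ n

IsMaximalIn : ∀ {n d} → LabeledHypergraph n d → Matroid d → Set
IsMaximalIn Δ M = InFamily Δ M × (∀ N → InFamily Δ N → M ≤w N → SameMatroid M N)

{-# OPTIONS --safe #-}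
module Submission where

-- A matroid N satisfies N ⪯ Δ and rank N ≤ n exactly when every member of the
-- generating collection (an (i+1)-subset of an edge of type i, or an (n+1)-set)
-- is N-dependent: both conditions just bound the size of independent subsets.
-- M has this property, because every member of the collection contains a
-- minimal one, which is a circuit of M. Conversely, for N in the family every
-- circuit of M lies in the collection and so is N-dependent; as every
-- M-dependent set contains a circuit of M, N ≤ M. Thus M is the greatest
-- element of the family, hence its unique maximal one.

open import Defs
open import Data.Bool as Bool using (true; false)
open import Data.Nat using (_+_; _≤_; zero; suc; z≤n; s≤s; _≤?_)
open import Data.Nat.Induction using (<-wellFounded)
open import Data.Nat.Properties using (≤-trans; ≤-reflexive; ⊔-lub; m≤n⇒m≤n⊔o; m≤n⇒m≤o⊔n; ≰⇒>; 1+n≰n)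
open import Data.Fin using (toℕ)
open import Data.Fin.Subset using (Subset; _⊆_; _⊂_; _∩_; _∪_; ∣_∣; ⊤; ⊥; inside; outside)
open import Data.Fin.Subset.Properties using (_⊆?_; _⊂?_; _∈?_; ⊆-antisym; ⊆-trans; ⊆-min; ⊆⊤; s⊆s; ∣⊥∣≡0; p⊂q⇒∣p∣<∣q∣)
open import Data.Vec using ([]; _∷_)
open import Data.List using (map; filter; _++_)
open import Data.List.Properties using (foldr-preservesᵇ; foldr-preservesᵒ)
open import Data.List.Membership.Propositional using () renaming (_∈_ to _∈ˡ_)
open import Data.List.Membership.Propositional.Properties using (∈-filter⁺; ∈-filter⁻; ∈-map⁺; ∈-map⁻; ∈-++⁺ˡ; ∈-++⁺ʳ)
open import Data.List.Relation.Unary.All as All using (All)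
open import Data.List.Relation.Unary.Any as Any using (here)
open import Data.Product using (_×_; ∃-syntax; _,_; proj₁)
open import Data.Sum using (inj₁; inj₂; [_,_])
open import Function.Bundles using (_⇔_; mk⇔; Equivalence)
open import Induction.WellFounded using (WellFounded; Acc; acc; module Subrelation)
import Relation.Binary.Construct.On as On
open import Relation.Binary.PropositionalEquality using (_≡_; refl; sym; trans; subst; cong)
open import Relation.Nullary using (¬_; yes; no; contradiction)
open import Relation.Nullary.Decidable using (_×-dec_)
open import Relation.Unary using (Decidable)

⊆∧⊄⇒≡ : ∀ {d} {p q : Subset d} → p ⊆ q → ¬ p ⊂ q → p ≡ q
⊆∧⊄⇒≡ {p = p} {q} p⊆q p⊄q = ⊆-antisym p⊆q q⊆p
  where
  q⊆p : q ⊆ p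
  q⊆p {x} x∈q with x ∈? p
  ... | yes x∈p = x∈p
  ... | no  x∉p = contradiction ((λ {y} → p⊆q {y}) , x , x∈q , x∉p) p⊄q

⊂-wellFounded : ∀ {d} → WellFounded (_⊂_ {d})
⊂-wellFounded =
  Subrelation.wellFounded p⊂q⇒∣p∣<∣q∣ (On.wellFounded ∣_∣ <-wellFounded)

⊆-of-size : ∀ {d} (p : Subset d) k → k ≤ ∣ p ∣ → ∃[ q ] (q ⊆ p × ∣ q ∣ ≡ k)
⊆-of-size [] zero _ = [] , (λ x∈q → x∈q) , refl
⊆-of-size (outside ∷ p) k k≤∣p∣ with ⊆-of-size p k k≤∣p∣
... | q , q⊆p , ∣q∣≡k = outside ∷ q , s⊆s q⊆p , ∣q∣≡k
⊆-of-size {suc d} (inside ∷ p) zero _ = ⊥ , ⊆-min _ , ∣⊥∣≡0 (suc d)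
⊆-of-size (inside ∷ p) (suc k) (s≤s k≤∣p∣) with ⊆-of-size p k k≤∣p∣
... | q , q⊆p , ∣q∣≡k = inside ∷ q , s⊆s q⊆p , cong suc ∣q∣≡k

∈-allSubsets : ∀ {d} (p : Subset d) → p ∈ˡ allSubsets d
∈-allSubsets [] = here refl
∈-allSubsets {suc d} (outside ∷ p) = ∈-++⁺ˡ (∈-map⁺ (outside ∷_) (∈-allSubsets p))
∈-allSubsets {suc d} (inside ∷ p) =
  ∈-++⁺ʳ (map (outside ∷_) (allSubsets d)) (∈-map⁺ (inside ∷_) (∈-allSubsets p))

∈⇒≤maxList : ∀ {v} xs → v ∈ˡ xs → v ≤ maxList xs
∈⇒≤maxList xs v∈xs =
  foldr-preservesᵒ (λ x y → [ m≤n⇒m≤n⊔o y , m≤n⇒m≤o⊔n x ]) 0 xs (inj₂ (Any.map ≤-reflexive v∈xs))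

maxList-lub : ∀ {k xs} → All (_≤ k) xs → maxList xs ≤ k
maxList-lub = foldr-preservesᵇ ⊔-lub z≤n

Minimal : ∀ {d} → (Subset d → Set) → Subset d → Set
Minimal P S = P S × (∀ T → T ⊆ S → P T → T ≡ S)

module _ {d} (N : Matroid d) where

  private
    independent⊆? : (A : Subset d) → Decidable (λ B → B ⊆ A × indep N B ≡ true)
    independent⊆? A B = (B ⊆? A) ×-dec (indep N B Bool.≟ true)

  -- Induction on ⊂: were S independent, so would be its proper subsets, hence by
  -- induction none of them satisfies P; then S is P-minimal and so dependent.
  minimal-dependent⇒dependent : (P : Subset d → Set) →
    (∀ S → Minimal P S → Dependent N S) → ∀ S → P S → Dependent N S
  minimal-dependent⇒dependent P minimal⇒dependent S = go S (⊂-wellFounded S)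
    where
    go : ∀ S → Acc _⊂_ S → P S → Dependent N S
    go S (acc smaller) PS with indep N S in S-indep
    ... | false = refl
    ... | true  = trans (sym S-indep) (minimal⇒dependent S (PS , minimal))
      where
      minimal : ∀ T → T ⊆ S → P T → T ≡ S
      minimal T T⊆S PT with T ⊂? S
      ... | no  T⊄S = ⊆∧⊄⇒≡ T⊆S T⊄S
      ... | yes T⊂S =
        contradiction (trans (sym (hereditary N S-indep T⊆S)) (go T (smaller T⊂S) PT)) λ ()

  independent⇒∣∣≤rank : ∀ {A B} → indep N B ≡ true → B ⊆ A → ∣ B ∣ ≤ rank N A
  independent⇒∣∣≤rank {A} {B} B-indep B⊆A =
    ∈⇒≤maxList _ (∈-map⁺ ∣_∣ (∈-filter⁺ (independent⊆? A) (∈-allSubsets B) (B⊆A , B-indep)))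

  rank-lub : ∀ A k → (∀ B → B ⊆ A → indep N B ≡ true → ∣ B ∣ ≤ k) → rank N A ≤ k
  rank-lub A k independent⇒≤k = maxList-lub (All.tabulate bounded)
    where
    bounded : ∀ {m} → m ∈ˡ map ∣_∣ (filter (independent⊆? A) (allSubsets d)) → m ≤ k
    bounded m∈ with ∈-map⁻ ∣_∣ m∈
    ... | B , B∈ , refl with ∈-filter⁻ (independent⊆? A) {xs = allSubsets d} B∈
    ... | _ , B⊆A , B-indep = independent⇒≤k B B⊆A B-indep

  rank≤⇔dependent : ∀ A k → rank N A ≤ k ⇔ (∀ S → S ⊆ A → ∣ S ∣ ≡ suc k → Dependent N S)
  rank≤⇔dependent A k = mk⇔ rank≤⇒dependent dependent⇒rank≤
    where
    rank≤⇒dependent : rank N A ≤ k → ∀ S → S ⊆ A → ∣ S ∣ ≡ suc k → Dependent N S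
    rank≤⇒dependent rank≤k S S⊆A ∣S∣≡1+k with indep N S in S-indep
    ... | false = refl
    ... | true  = contradiction
      (subst (_≤ k) ∣S∣≡1+k (≤-trans (independent⇒∣∣≤rank S-indep S⊆A) rank≤k)) 1+n≰n

    dependent⇒rank≤ : (∀ S → S ⊆ A → ∣ S ∣ ≡ suc k → Dependent N S) → rank N A ≤ k
    dependent⇒rank≤ dependent = rank-lub A k bounded
      where
      bounded : ∀ B → B ⊆ A → indep N B ≡ true → ∣ B ∣ ≤ k
      bounded B B⊆A B-indep with ∣ B ∣ ≤? k
      ... | yes ∣B∣≤k = ∣B∣≤k
      ... | no  ∣B∣≰k with ⊆-of-size B (suc k) (≰⇒> ∣B∣≰k)
      ... | S , S⊆B , ∣S∣≡1+k = contradiction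
        (trans (sym (hereditary N B-indep S⊆B)) (dependent S (⊆-trans S⊆B B⊆A) ∣S∣≡1+k)) λ ()

≤w-antisym : ∀ {d} {N₁ N₂ : Matroid d} → N₁ ≤w N₂ → N₂ ≤w N₁ → SameMatroid N₁ N₂
≤w-antisym {N₁ = N₁} {N₂} N₁≤N₂ N₂≤N₁ A with indep N₁ A in N₁A | indep N₂ A in N₂A
... | false | false = refl
... | true  | true  = refl
... | false | true  = sym (trans (sym N₂A) (N₂≤N₁ A N₁A))
... | true  | false = trans (sym N₁A) (N₁≤N₂ A N₂A)

module _ {n d} (Δ : LabeledHypergraph n d) where

  inFamily⇔collection-dependent : ∀ N → InFamily Δ N ⇔ (∀ S → InCollection Δ S → Dependent N S)
  inFamily⇔collection-dependent N = mk⇔ inFamily⇒dependent dependent⇒inFamily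
    where
    open Equivalence
    inFamily⇒dependent : InFamily Δ N → ∀ S → InCollection Δ S → Dependent N S
    inFamily⇒dependent (N⪯Δ , _) S (inj₁ (i , e , e∈Δᵢ , S⊆e , ∣S∣≡1+i)) =
      to (rank≤⇔dependent N e (toℕ i)) (N⪯Δ i e e∈Δᵢ) S S⊆e ∣S∣≡1+i
    inFamily⇒dependent (_ , rank≤n) S (inj₂ ∣S∣≡1+n) =
      to (rank≤⇔dependent N ⊤ n) rank≤n S ⊆⊤ ∣S∣≡1+n

    dependent⇒inFamily : (∀ S → InCollection Δ S → Dependent N S) → InFamily Δ N
    dependent⇒inFamily dependent =
        (λ i e e∈Δᵢ → from (rank≤⇔dependent N e (toℕ i)) λ S S⊆e ∣S∣≡1+i →
          dependent S (inj₁ (i , e , e∈Δᵢ , S⊆e , ∣S∣≡1+i)))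
      , from (rank≤⇔dependent N ⊤ n) λ S _ ∣S∣≡1+n → dependent S (inj₂ ∣S∣≡1+n)

  greatest⇒unique-maximal : ∀ M → InFamily Δ M → (∀ N → InFamily Δ N → N ≤w M) →
    IsMaximalIn Δ M × (∀ N → IsMaximalIn Δ N → SameMatroid N M)
  greatest⇒unique-maximal M M∈ greatest =
      (M∈ , λ N N∈ M≤N → ≤w-antisym {N₁ = M} {N} M≤N (greatest N N∈))
    , λ N (N∈ , N-maximal) → N-maximal M M∈ (greatest N N∈)

  module _ (M : Matroid d) (circuits : ∀ C → IsCircuit M C ⇔ MinimalInCollection Δ C) where
    open Equivalence

    collection-dependent : ∀ S → InCollection Δ S → Dependent M S
    collection-dependent = minimal-dependent⇒dependent M (InCollection Δ)
      λ S (S∈ , minimal) → proj₁ (from (circuits S) (S∈ , λ T T∈ T⊆S → minimal T T⊆S T∈))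

    inFamily⇒≤w : ∀ N → InFamily Δ N → N ≤w M
    inFamily⇒≤w N N∈ = minimal-dependent⇒dependent N (Dependent M)
      λ C circuit → to (inFamily⇔collection-dependent N) N∈ C (proj₁ (to (circuits C) circuit))

lemma4p5 : ∀ {n d} (Δ : LabeledHypergraph n d) →
    (∀ i j e₁ e₂ → e₁ ∈Δ[ i ] Δ → e₂ ∈Δ[ j ] Δ →
      vΔ Δ (e₁ ∩ e₂) + vΔ Δ (e₁ ∪ e₂) ≤ toℕ i + toℕ j) →
    (M : Matroid d) →
    (∀ C → IsCircuit M C ⇔ MinimalInCollection Δ C) →
    IsMaximalIn Δ M × (∀ N → IsMaximalIn Δ N → SameMatroid N M)
-- The inequality is what makes the collection's minimal sets the circuits of a
-- matroid.
lemma4p5 Δ _ M circuits = greatest⇒unique-maximal Δ M M∈ (inFamily⇒≤w Δ M circuits)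
  where
  M∈ : InFamily Δ M
  M∈ = Equivalence.from (inFamily⇔collection-dependent Δ M) (collection-dependent Δ M circuits)
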